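{- For every integer $k\ge 1$, $n(\ell_k,\ell_k)=c_k$.
   Context: A rooted tree is a finite tree with a distinguished vertex (the root); its leaves are the non-root vertices of degree $1$, and an internal edge is an edge not incident to a leaf. Given rooted trees $t_1,t_2$ with the same number of leaves, a gluing is a bijection $\sigma$ from the leaves of $t_1$ to the leaves of $t_2$; its associated graph is obtained from the disjoint union of $t_1$ and $t_2$ by identifying each leaf $u$ of $t_1$ with $\sigma(u)$ and then suppressing each resulting 2-valent vertex (contracting one of its two incident edges), so that each glued pair becomes a single edge joining the parent of $u$ to the parent of $\sigma(u)$. The gluing has a subdivergence if there exist an internal edge $e_1$ of $t_1$ and an internal edge $e_2$ of $t_2$ such that $\{e_1,e_2\}$ is a 2-edge cut of this graph and one of the two resulting components contains neither the root of $t_1$ nor the root of $t_2$. $n(t_1,t_2)$ is the number of gluings (bijections) with no subdivergence. $\ell_k$ is the rooted tree with $k$ internal (non-leaf) vertices forming a path with the root at one end, and exactly one leaf attached to each internal vertex. A connected permutation of size $k$ is a permutation $\sigma$ of $\{1,\dots,k\}$ with $\sigma(\{1,\dots,j\})\ne\{1,\dots,j\}$ for all $j\in\{1,\dots,k-1\}$; $c_k$ denotes their number. -}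

module Defs where

open import Level using (Level)
open import Data.Nat using (ℕ; zero; suc; _≤_; _<_)
import Data.Fin as Fin
open import Data.Fin using (Fin; toℕ; inject₁)
open import Data.Vec using (Vec; lookup)
open import Data.List using (List; length)
open import Data.List.Relation.Unary.Unique.Propositional using (Unique)
open import Data.List.Membership.Propositional using (_∈_)
open import Data.Product using (Σ; ∃; _×_; _,_)
open import Data.Sum using (_⊎_; inj₁; inj₂)
open import Relation.Binary.PropositionalEquality using (_≡_)
open import Relation.Nullary using (¬_)
open import Function.Definitions using (Bijective)
open import Function.Bundles using (_⇔_)

HasCount : {A : Set} → (A → Set) → ℕ → Set
HasCount {A} P m =
  Σ (List A) λ L → Unique L × length L ≡ m × (∀ x → (x ∈ L) ⇔ P x)

-- Maps Fin k → Fin k represented by their table of values (a vector),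
-- so that two maps are equal iff they are extensionally equal.

IsBijection : {k : ℕ} → Vec (Fin k) k → Set
IsBijection σ = Bijective _≡_ _≡_ (lookup σ)

-- Connected permutations of {1,…,k}, written 0-indexed on Fin k:
-- {1,…,j} corresponds to {x : Fin k | toℕ x < j}.

FixesInitialSegment : {k : ℕ} → Vec (Fin k) k → ℕ → Set
FixesInitialSegment {k} σ j =
  ∀ (y : Fin k) → (Σ (Fin k) λ x → toℕ x < j × lookup σ x ≡ y) ⇔ (toℕ y < j)

IsConnectedPermutation : {k : ℕ} → Vec (Fin k) k → Set
IsConnectedPermutation {k} σ =
  IsBijection σ × (∀ j → 1 ≤ j → j < k → ¬ FixesInitialSegment σ j)

-- ℓ_k has internal vertices v₀,…,v_{k-1} (0-indexed; v₀ is the root),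
-- path edges v_i — v_{i+1} (i : Fin n; these are exactly the internal
-- edges) and one leaf edge v_i — (leaf i).  A gluing is a bijection σ from
-- the leaves of the first copy to the leaves of the second copy; leaf i of
-- the first copy is glued to leaf (σ i) of the second copy and the
-- resulting 2-valent vertex is suppressed, giving an edge joining
-- v_i (first copy) to v_{σ i} (second copy).

module LadderGluing (n : ℕ) (σ : Vec (Fin (suc n)) (suc n)) where

  -- vertices: inj₁ i = v_i of the first copy, inj₂ i = v_i of the second
  Vertex : Set
  Vertex = Fin (suc n) ⊎ Fin (suc n)

  root₁ root₂ : Vertex
  root₁ = inj₁ Fin.zero
  root₂ = inj₂ Fin.zero

  data Edge : Set where
    int₁  : Fin n → Edge
    int₂  : Fin n → Edge
    glued : Fin (suc n) → Edge

  ends : Edge → Vertex × Vertex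
  ends (int₁ i)  = inj₁ (inject₁ i) , inj₁ (Fin.suc i)
  ends (int₂ i)  = inj₂ (inject₁ i) , inj₂ (Fin.suc i)
  ends (glued i) = inj₁ i , inj₂ (lookup σ i)

  Joins : Edge → Vertex → Vertex → Set
  Joins e x y = (ends e ≡ (x , y)) ⊎ (ends e ≡ (y , x))

  data Reach (removed : Edge → Set) (x : Vertex) : Vertex → Set where
    here : Reach removed x x
    step : ∀ {y z} (e : Edge) → ¬ removed e → Joins e y z →
           Reach removed x y → Reach removed x z

  IsEdgeCut : (Edge → Set) → Set
  IsEdgeCut removed = Σ Vertex λ x → Σ Vertex λ y → ¬ Reach removed x y

  HasSubdivergence : Set
  HasSubdivergence =
    Σ (Fin n) λ i → Σ (Fin n) λ j →
      let removed : Edge → Set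
          removed e = (e ≡ int₁ i) ⊎ (e ≡ int₂ j)
      in IsEdgeCut removed ×
         (Σ Vertex λ w → ¬ Reach removed root₁ w × ¬ Reach removed root₂ w)

IsSubdivergenceFreeGluing : (n : ℕ) → Vec (Fin (suc n)) (suc n) → Set
IsSubdivergenceFreeGluing n σ =
  IsBijection σ × ¬ LadderGluing.HasSubdivergence n σ

-- If a bijection σ maps {v₀,…,v_i} onto itself for some i < k − 1, cutting
-- the path edges v_i — v_{i+1} in both copies separates the two "upper"
-- halves from the roots, a subdivergence.  Conversely, if cutting
-- v_i — v_{i+1} in copy 1 and v_j — v_{j+1} in copy 2 leaves a rootless
-- component, then no glued edge may join a lower half to an upper half
-- (otherwise both upper halves, which are joined to each other through the
-- glued edges at the top vertices, would hang from a root); so σ maps the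
-- lower half {≤ i} bijectively onto {≤ j}, forcing i = j.  Hence the two
-- predicates agree pointwise, and both are counted by enumerating all maps.

module Submission where

open import Defs
open import Data.Empty using (⊥; ⊥-elim)
open import Data.Fin using (Fin; toℕ; fromℕ; fromℕ<; inject₁; inject≤)
import Data.Fin as Fin
import Data.Fin.Properties as Finₚ
open import Data.Fin.Induction using (<-weakInduction; >-weakInduction)
open import Data.List using (List; [_]; length; filter; deduplicate; allFin; cartesianProductWith)
open import Data.List.Membership.Propositional using (_∈_)
open import Data.List.Membership.Propositional.Properties
  using (∈-filter⁺; ∈-filter⁻; ∈-deduplicate⁺; ∈-cartesianProductWith⁺; ∈-allFin)
open import Data.List.Relation.Unary.Any using (here)
open import Data.List.Relation.Unary.Unique.Propositional.Properties using (filter⁺)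
open import Data.List.Relation.Unary.Unique.DecPropositional.Properties using (deduplicate-!)
open import Data.Nat using (ℕ; zero; suc; _≤_; _<_; _≤?_; _<?_; z≤n; s≤s; s≤s⁻¹)
import Data.Nat.Properties as ℕₚ
open import Data.Product using (Σ; ∃; _×_; _,_; proj₁; proj₂; uncurry)
open import Data.Sum using (_⊎_; inj₁; inj₂)
open import Data.Vec using (Vec; lookup; []; _∷_)
open import Data.Vec.Properties using (≡-dec)
open import Function using (_∘_)
open import Function.Bundles using (_⇔_; mk⇔; Equivalence)
open import Function.Construct.Composition using (_⇔-∘_)
open import Function.Construct.Symmetry using (⇔-sym)
open import Function.Definitions using (Injective; Surjective)
open import Relation.Binary using (DecidableEquality; IsEquivalence; Rel)
import Relation.Binary.Construct.On as On
open import Relation.Binary.PropositionalEquality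
  using (_≡_; _≢_; refl; sym; trans; cong; subst; module ≡-Reasoning)
open import Relation.Nullary using (Dec; yes; no; ¬_)
open import Relation.Nullary.Decidable using (map′; _×-dec_; _→-dec_; ¬?)
open import Relation.Unary using (Decidable)

open Equivalence using (to; from)

vecs : (k m : ℕ) → List (Vec (Fin k) m)
vecs k zero    = [ [] ]
vecs k (suc m) = cartesianProductWith _∷_ (allFin k) (vecs k m)

∈-vecs : ∀ {k m} (v : Vec (Fin k) m) → v ∈ vecs k m
∈-vecs []      = here refl
∈-vecs (x ∷ v) = ∈-cartesianProductWith⁺ _∷_ (∈-allFin x) (∈-vecs v)

decidable⇒hasCount : {A : Set} → DecidableEquality A → (L : List A) → (∀ x → x ∈ L) →
                     {P : A → Set} → Decidable P → ∃ (HasCount P)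
decidable⇒hasCount _≟_ L complete P? =
  length L′ , L′ , filter⁺ P? (deduplicate-! _≟_ L) , refl ,
  λ x → mk⇔ (proj₂ ∘ ∈-filter⁻ P? {xs = deduplicate _≟_ L}) (∈-filter⁺ P? (∈-deduplicate⁺ _≟_ (complete x)))
  where
  L′ = filter P? (deduplicate _≟_ L)

hasCount-resp-⇔ : {A : Set} {P Q : A → Set} {m : ℕ} →
                  (∀ x → P x ⇔ Q x) → HasCount P m → HasCount Q m
hasCount-resp-⇔ P⇔Q (L , unique , length≡m , ∈⇔P) =
  L , unique , length≡m , λ x → P⇔Q x ⇔-∘ ∈⇔P x

_⇔-dec_ : {A B : Set} → Dec A → Dec B → Dec (A ⇔ B)
a? ⇔-dec b? = map′ (uncurry mk⇔) (λ e → to e , from e) ((a? →-dec b?) ×-dec (b? →-dec a?))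

module _ {k : ℕ} (σ : Vec (Fin k) k) where

  isBijection? : Dec (IsBijection σ)
  isBijection? = injective? ×-dec surjective?
    where
    injective? : Dec (Injective _≡_ _≡_ (lookup σ))
    injective? = map′ (λ h {x} {y} → h x y) (λ h x y → h)
      (Finₚ.all? λ x → Finₚ.all? λ y → (lookup σ x Finₚ.≟ lookup σ y) →-dec (x Finₚ.≟ y))

    surjective? : Dec (Surjective _≡_ _≡_ (lookup σ))
    surjective? = map′ (λ h y → proj₁ (h y) , λ { refl → proj₂ (h y) })
                       (λ h y → proj₁ (h y) , proj₂ (h y) refl)
      (Finₚ.all? λ y → Finₚ.any? λ x → lookup σ x Finₚ.≟ y)

  fixesInitialSegment? : ∀ j → Dec (FixesInitialSegment σ j)
  fixesInitialSegment? j = Finₚ.all? λ y →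
    Finₚ.any? (λ x → (toℕ x <? j) ×-dec (lookup σ x Finₚ.≟ y)) ⇔-dec (toℕ y <? j)

  isConnectedPermutation? : Dec (IsConnectedPermutation σ)
  isConnectedPermutation? = isBijection? ×-dec
    map′ (λ h j 1≤j j<k → h j<k 1≤j) (λ h {j} j<k 1≤j → h j 1≤j j<k)
         (ℕₚ.allUpTo? (λ j → (1 ≤? j) →-dec ¬? (fixesInitialSegment? j)) k)

injective⇒initialSegment-≤ : ∀ {K L} (h : Fin K → Fin L) → Injective _≡_ _≡_ h →
  ∀ {a b} → a ≤ K → (∀ x → toℕ x < a → toℕ (h x) < b) → a ≤ b
injective⇒initialSegment-≤ {K} h h-injective {a} {b} a≤K h[<a]<b =
  Finₚ.injective⇒≤ restriction-injective
  where
  embed : Fin a → Fin K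
  embed x = inject≤ x a≤K

  restriction : Fin a → Fin b
  restriction x =
    fromℕ< (h[<a]<b (embed x) (subst (_< a) (sym (Finₚ.toℕ-inject≤ x a≤K)) (Finₚ.toℕ<n x)))

  toℕ-restriction : ∀ x → toℕ (restriction x) ≡ toℕ (h (embed x))
  toℕ-restriction x = Finₚ.toℕ-fromℕ< _

  restriction-injective : Injective _≡_ _≡_ restriction
  restriction-injective {x} {y} eq = Finₚ.inject≤-injective a≤K a≤K x y (h-injective
    (Finₚ.toℕ-injective (begin
      toℕ (h (embed x))    ≡⟨ sym (toℕ-restriction x) ⟩
      toℕ (restriction x)  ≡⟨ cong toℕ eq ⟩
      toℕ (restriction y)  ≡⟨ toℕ-restriction y ⟩
      toℕ (h (embed y))    ∎)))
    where open ≡-Reasoning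

module _ {k : ℕ} {f : Fin k → Fin k} (f-surjective : Surjective _≡_ _≡_ f) where

  section : Fin k → Fin k
  section y = proj₁ (f-surjective y)

  section-inverseʳ : ∀ y → f (section y) ≡ y
  section-inverseʳ y = proj₂ (f-surjective y) refl

  section-injective : Injective _≡_ _≡_ section
  section-injective {y} {y′} eq =
    trans (sym (section-inverseʳ y)) (trans (cong f eq) (section-inverseʳ y′))

module PathSides {n ℓ} {_~_ : Rel (Fin (suc n)) ℓ} (isEquivalence : IsEquivalence _~_)
                 (cut : ℕ) (~-step : ∀ (a : Fin n) → toℕ a ≢ cut → inject₁ a ~ Fin.suc a) where
  open IsEquivalence isEquivalence renaming (refl to ~-refl; sym to ~-sym; trans to ~-trans)

  zero~below : ∀ y → toℕ y ≤ cut → Fin.zero ~ y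
  zero~below = <-weakInduction (λ y → toℕ y ≤ cut → Fin.zero ~ y) (λ _ → ~-refl) extend
    where
    extend : ∀ a → (toℕ (inject₁ a) ≤ cut → Fin.zero ~ inject₁ a) →
             toℕ (Fin.suc a) ≤ cut → Fin.zero ~ Fin.suc a
    extend a ih a<cut = ~-trans (ih (subst (_≤ cut) (sym (Finₚ.toℕ-inject₁ a)) (ℕₚ.<⇒≤ a<cut)))
                                (~-step a (ℕₚ.<⇒≢ a<cut))

  above~top : ∀ y → cut < toℕ y → y ~ fromℕ n
  above~top = >-weakInduction (λ y → cut < toℕ y → y ~ fromℕ n) (λ _ → ~-refl) extend
    where
    extend : ∀ a → (cut < toℕ (Fin.suc a) → Fin.suc a ~ fromℕ n) →
             cut < toℕ (inject₁ a) → inject₁ a ~ fromℕ n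
    extend a ih cut<a′ = ~-trans (~-step a (ℕₚ.>⇒≢ cut<a)) (ih (ℕₚ.m<n⇒m<1+n cut<a))
      where
      cut<a : cut < toℕ a
      cut<a = subst (cut <_) (Finₚ.toℕ-inject₁ a) cut<a′

  ~-above : ∀ {x y} → cut < toℕ x → cut < toℕ y → x ~ y
  ~-above {x} {y} cut<x cut<y = ~-trans (above~top x cut<x) (~-sym (above~top y cut<y))

module _ (n : ℕ) (σ : Vec (Fin (suc n)) (suc n)) where
  open LadderGluing n σ

  module _ {removed : Edge → Set} where

    Reach-trans : ∀ {x y z} → Reach removed x y → Reach removed y z → Reach removed x z
    Reach-trans p here                 = p
    Reach-trans p (step e ¬r e⟨y,z⟩ q) = step e ¬r e⟨y,z⟩ (Reach-trans p q)

    Joins-sym : ∀ {e y z} → Joins e y z → Joins e z y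
    Joins-sym (inj₁ eq) = inj₂ eq
    Joins-sym (inj₂ eq) = inj₁ eq

    Reach-sym : ∀ {x y} → Reach removed x y → Reach removed y x
    Reach-sym here                 = here
    Reach-sym (step e ¬r e⟨y,z⟩ p) = Reach-trans (step e ¬r (Joins-sym e⟨y,z⟩) here) (Reach-sym p)

    Reach-isEquivalence : IsEquivalence (Reach removed)
    Reach-isEquivalence = record { refl = here ; sym = Reach-sym ; trans = Reach-trans }

  CutAt : Fin n → Fin n → Edge → Set
  CutAt i j e = (e ≡ int₁ i) ⊎ (e ≡ int₂ j)

  top : Fin (suc n)
  top = fromℕ n

  <top : (i : Fin n) → toℕ i < toℕ top
  <top i = subst (toℕ i <_) (sym (Finₚ.toℕ-fromℕ n)) (Finₚ.toℕ<n i)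

  fixesInitialSegment⇒hasSubdivergence : Injective _≡_ _≡_ (lookup σ) →
    ∀ j → 1 ≤ j → j < suc n → FixesInitialSegment σ j → HasSubdivergence
  fixesInitialSegment⇒hasSubdivergence σ-injective (suc j′) _ (s≤s j′<n) fixes =
    i , i , (root₁ , inj₁ top , lower-cannot-reach-top (s≤s z≤n)) ,
    inj₁ top , lower-cannot-reach-top (s≤s z≤n) , lower-cannot-reach-top (s≤s z≤n)
    where
    i : Fin n
    i = fromℕ< j′<n

    Lower : Vertex → Set
    Lower (inj₁ x) = toℕ x < suc j′
    Lower (inj₂ x) = toℕ x < suc j′

    toℕ≡j′⇒≡i : ∀ {a} → toℕ a ≡ j′ → a ≡ i
    toℕ≡j′⇒≡i a≡j′ = Finₚ.toℕ-injective (trans a≡j′ (sym (Finₚ.toℕ-fromℕ< j′<n)))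

    up : ∀ a → toℕ a ≢ j′ → toℕ (inject₁ a) < suc j′ → toℕ (Fin.suc a) < suc j′
    up a a≢j′ a<1+j′ =
      s≤s (ℕₚ.≤∧≢⇒< (s≤s⁻¹ (subst (_< suc j′) (Finₚ.toℕ-inject₁ a) a<1+j′)) a≢j′)

    down : ∀ a → toℕ (Fin.suc a) < suc j′ → toℕ (inject₁ a) < suc j′
    down a 1+a<1+j′ =
      subst (_< suc j′) (sym (Finₚ.toℕ-inject₁ a)) (ℕₚ.<-trans (ℕₚ.n<1+n _) 1+a<1+j′)

    Lower-closed : ∀ {u v} → Reach (CutAt i i) u v → Lower u → Lower v
    Lower-closed here lower = lower
    Lower-closed (step (int₁ a) kept (inj₁ refl) p) lower =
      up a (kept ∘ inj₁ ∘ cong int₁ ∘ toℕ≡j′⇒≡i) (Lower-closed p lower)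
    Lower-closed (step (int₁ a) _ (inj₂ refl) p) lower = down a (Lower-closed p lower)
    Lower-closed (step (int₂ a) kept (inj₁ refl) p) lower =
      up a (kept ∘ inj₂ ∘ cong int₂ ∘ toℕ≡j′⇒≡i) (Lower-closed p lower)
    Lower-closed (step (int₂ a) _ (inj₂ refl) p) lower = down a (Lower-closed p lower)
    Lower-closed (step (glued x) _ (inj₁ refl) p) lower =
      to (fixes (lookup σ x)) (x , Lower-closed p lower , refl)
    Lower-closed (step (glued x) _ (inj₂ refl) p) lower
      with from (fixes (lookup σ x)) (Lower-closed p lower)
    ... | x′ , x′<1+j′ , σx′≡σx = subst (λ t → toℕ t < suc j′) (σ-injective σx′≡σx) x′<1+j′

    lower-cannot-reach-top : ∀ {u} → Lower u → ¬ Reach (CutAt i i) u (inj₁ top)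
    lower-cannot-reach-top lower p = ℕₚ.<-irrefl refl (ℕₚ.<-≤-trans j′<n
      (s≤s⁻¹ (subst (_< suc j′) (Finₚ.toℕ-fromℕ n) (Lower-closed p lower))))

  module SubdivergenceAnalysis (σ-bijective : IsBijection σ) (i j : Fin n) (w : Vertex)
           (w≁root₁ : ¬ Reach (CutAt i j) root₁ w) (w≁root₂ : ¬ Reach (CutAt i j) root₂ w) where

    σ-injective = proj₁ σ-bijective
    σ-surjective = proj₂ σ-bijective

    Rooted : Vertex → Set
    Rooted v = Reach (CutAt i j) root₁ v ⊎ Reach (CutAt i j) root₂ v

    Rooted-extend : ∀ {u v} → Rooted u → Reach (CutAt i j) u v → Rooted v
    Rooted-extend (inj₁ p) q = inj₁ (Reach-trans p q)
    Rooted-extend (inj₂ p) q = inj₂ (Reach-trans p q)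

    glued-kept : ∀ {x} → ¬ CutAt i j (glued x)
    glued-kept (inj₁ ())
    glued-kept (inj₂ ())

    Rooted-glued₁₂ : ∀ x → Rooted (inj₁ x) → Rooted (inj₂ (lookup σ x))
    Rooted-glued₁₂ x r = Rooted-extend r (step (glued x) glued-kept (inj₁ refl) here)

    Rooted-glued₂₁ : ∀ x → Rooted (inj₂ (lookup σ x)) → Rooted (inj₁ x)
    Rooted-glued₂₁ x r = Rooted-extend r (step (glued x) glued-kept (inj₂ refl) here)

    int₁-kept : ∀ a → toℕ a ≢ toℕ i → ¬ CutAt i j (int₁ a)
    int₁-kept a a≢i (inj₁ refl) = a≢i refl
    int₁-kept a a≢i (inj₂ ())

    int₂-kept : ∀ a → toℕ a ≢ toℕ j → ¬ CutAt i j (int₂ a)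
    int₂-kept a a≢j (inj₁ ())
    int₂-kept a a≢j (inj₂ refl) = a≢j refl

    step₁ : ∀ a → toℕ a ≢ toℕ i → Reach (CutAt i j) (inj₁ (inject₁ a)) (inj₁ (Fin.suc a))
    step₁ a a≢i = step (int₁ a) (int₁-kept a a≢i) (inj₁ refl) here

    step₂ : ∀ a → toℕ a ≢ toℕ j → Reach (CutAt i j) (inj₂ (inject₁ a)) (inj₂ (Fin.suc a))
    step₂ a a≢j = step (int₂ a) (int₂-kept a a≢j) (inj₁ refl) here

    module Copy₁ = PathSides (On.isEquivalence inj₁ Reach-isEquivalence) (toℕ i) step₁
    module Copy₂ = PathSides (On.isEquivalence inj₂ Reach-isEquivalence) (toℕ j) step₂

    spread₁ : ∀ {h} → toℕ i < toℕ h → Rooted (inj₁ h) → ∀ x → Rooted (inj₁ x)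
    spread₁ i<h r x with toℕ x ≤? toℕ i
    ... | yes x≤i = inj₁ (Copy₁.zero~below x x≤i)
    ... | no  x≰i = Rooted-extend r (Copy₁.~-above i<h (ℕₚ.≰⇒> x≰i))

    spread₂ : ∀ {h} → toℕ j < toℕ h → Rooted (inj₂ h) → ∀ y → Rooted (inj₂ y)
    spread₂ j<h r y with toℕ y ≤? toℕ j
    ... | yes y≤j = inj₂ (Copy₂.zero~below y y≤j)
    ... | no  y≰j = Rooted-extend r (Copy₂.~-above j<h (ℕₚ.≰⇒> y≰j))

    not-everything-rooted : (∀ x → Rooted (inj₁ x)) → (∀ y → Rooted (inj₂ y)) → ⊥
    not-everything-rooted all₁ all₂ = w-unrooted (everything w)
      where
      everything : ∀ v → Rooted v
      everything (inj₁ x) = all₁ x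
      everything (inj₂ y) = all₂ y

      w-unrooted : ¬ Rooted w
      w-unrooted (inj₁ p) = w≁root₁ p
      w-unrooted (inj₂ p) = w≁root₂ p

    -- The two upper halves are joined by the glued edges ending at their tops.
    upper₁-unrooted : ∀ {h} → toℕ i < toℕ h → ¬ Rooted (inj₁ h)
    upper₁-unrooted i<h r = not-everything-rooted all₁ all₂
      where
      all₁ = spread₁ i<h r
      t = section σ-surjective top
      all₂ = spread₂ (<top j) (subst (Rooted ∘ inj₂) (section-inverseʳ σ-surjective top)
                                      (Rooted-glued₁₂ t (all₁ t)))

    upper₂-unrooted : ∀ {h} → toℕ j < toℕ h → ¬ Rooted (inj₂ h)
    upper₂-unrooted j<h r = not-everything-rooted all₁ all₂
      where
      all₂ = spread₂ j<h r
      all₁ = spread₁ (<top i) (Rooted-glued₂₁ top (all₂ (lookup σ top)))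

    σ-maps-lower : ∀ x → toℕ x ≤ toℕ i → toℕ (lookup σ x) ≤ toℕ j
    σ-maps-lower x x≤i with toℕ (lookup σ x) ≤? toℕ j
    ... | yes σx≤j = σx≤j
    ... | no  σx≰j = ⊥-elim (upper₂-unrooted (ℕₚ.≰⇒> σx≰j)
                               (Rooted-glued₁₂ x (inj₁ (Copy₁.zero~below x x≤i))))

    σ-reflects-lower : ∀ x → toℕ (lookup σ x) ≤ toℕ j → toℕ x ≤ toℕ i
    σ-reflects-lower x σx≤j with toℕ x ≤? toℕ i
    ... | yes x≤i = x≤i
    ... | no  x≰i = ⊥-elim (upper₁-unrooted (ℕₚ.≰⇒> x≰i)
                               (Rooted-glued₂₁ x (inj₂ (Copy₂.zero~below (lookup σ x) σx≤j))))

    σ⁻¹-maps-lower : ∀ y → toℕ y ≤ toℕ j → toℕ (section σ-surjective y) ≤ toℕ i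
    σ⁻¹-maps-lower y y≤j = σ-reflects-lower (section σ-surjective y)
      (subst (λ t → toℕ t ≤ toℕ j) (sym (section-inverseʳ σ-surjective y)) y≤j)

    i≡j : toℕ i ≡ toℕ j
    i≡j = ℕₚ.≤-antisym
      (s≤s⁻¹ (injective⇒initialSegment-≤ (lookup σ) σ-injective (ℕₚ.m≤n⇒m≤1+n (Finₚ.toℕ<n i))
                (λ x → s≤s ∘ σ-maps-lower x ∘ s≤s⁻¹)))
      (s≤s⁻¹ (injective⇒initialSegment-≤ (section σ-surjective) (section-injective σ-surjective)
                (ℕₚ.m≤n⇒m≤1+n (Finₚ.toℕ<n j)) (λ y → s≤s ∘ σ⁻¹-maps-lower y ∘ s≤s⁻¹)))

    fixesInitialSegment : FixesInitialSegment σ (suc (toℕ i))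
    fixesInitialSegment y = mk⇔
      (λ { (x , x<1+i , refl) → s≤s (subst (toℕ (lookup σ x) ≤_) (sym i≡j)
                                             (σ-maps-lower x (s≤s⁻¹ x<1+i))) })
      (λ y<1+i → section σ-surjective y ,
                 s≤s (σ⁻¹-maps-lower y (subst (toℕ y ≤_) i≡j (s≤s⁻¹ y<1+i))) ,
                 section-inverseʳ σ-surjective y)

  subdivergenceFree⇔connected : IsSubdivergenceFreeGluing n σ ⇔ IsConnectedPermutation σ
  subdivergenceFree⇔connected = mk⇔
    (λ (bijective , no-subdivergence) → bijective , λ j 1≤j j<k fixes →
       no-subdivergence (fixesInitialSegment⇒hasSubdivergence (proj₁ bijective) j 1≤j j<k fixes))
    (λ (bijective , connected) → bijective , λ (i , j , _ , w , w≁root₁ , w≁root₂) →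
       connected (suc (toℕ i)) (s≤s z≤n) (s≤s (Finₚ.toℕ<n i))
         (SubdivergenceAnalysis.fixesInitialSegment bijective i j w w≁root₁ w≁root₂))

mainTheorem2 : (n : ℕ) → Σ ℕ λ m →
    HasCount (IsSubdivergenceFreeGluing n) m ×
    HasCount (IsConnectedPermutation {suc n}) m
mainTheorem2 n =
  m , hasCount-resp-⇔ (λ σ → ⇔-sym (subdivergenceFree⇔connected n σ)) connected-count , connected-count
  where
  counted = decidable⇒hasCount (≡-dec Finₚ._≟_) (vecs (suc n) (suc n)) ∈-vecs isConnectedPermutation?
  m = proj₁ counted
  connected-count = proj₂ counted
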